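{- For every integer $k \ge 1$, there exists a quasi-perfect $2$-error-correcting code in each of the following Cartesian products: (1) $C_{14} \square C_{14} \square C_{4k}$; (2) $C_n \square C_n \square C_{6k}$ for every $n$ with $14 \le n \le 19$.
   Context: All graphs are simple and connected; $d(x,y)$ is the shortest-path distance. For $n\ge 3$, $C_n$ is the cycle on $n$ vertices. The Cartesian product $G\square H$ has vertex set $V(G)\times V(H)$, with $(g_1,h_1)$ adjacent to $(g_2,h_2)$ iff either $h_1=h_2$ and $g_1g_2\in E(G)$, or $g_1=g_2$ and $h_1h_2\in E(H)$. A code is a subset $D$ of the vertex set. $D$ is $t$-error-correcting if any two distinct codewords are at distance at least $2t+1$. The covering radius of $D$ is the smallest $r$ such that every vertex is at distance at most $r$ from some codeword. A quasi-perfect $t$-error-correcting code is a $t$-error-correcting code with covering radius $t+1$. -}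

module Defs where

open import Data.Nat using (ℕ; zero; suc; _+_; _≤_; _*_)
open import Data.Nat.DivMod using (_%_)
open import Data.Fin using (Fin; toℕ)
open import Data.Product using (Σ; _×_; _,_; ∃)
open import Data.Sum using (_⊎_)
open import Data.Empty using (⊥)
open import Relation.Nullary using (¬_)
open import Relation.Binary.PropositionalEquality using (_≡_)

record Graph : Set₁ where
  field
    V   : Set
    Adj : V → V → Set
open Graph public

CycleAdj : (n : ℕ) → Fin n → Fin n → Set
CycleAdj zero () _
CycleAdj (suc m) i j =
  (suc (toℕ i) % suc m ≡ toℕ j) ⊎ (suc (toℕ j) % suc m ≡ toℕ i)

Cycle : ℕ → Graph
Cycle n = record { V = Fin n ; Adj = CycleAdj n }

_□_ : Graph → Graph → Graph
G □ H = record
  { V   = V G × V H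
  ; Adj = λ { (g₁ , h₁) (g₂ , h₂) →
              (h₁ ≡ h₂ × Adj G g₁ g₂) ⊎ (g₁ ≡ g₂ × Adj H h₁ h₂) } }
infixl 6 _□_

data Walk (G : Graph) : ℕ → V G → V G → Set where
  here : ∀ {x} → Walk G zero x x
  step : ∀ {k x y z} → Adj G x y → Walk G k y z → Walk G (suc k) x z

DistLe : (G : Graph) → ℕ → V G → V G → Set
DistLe G r x y = Σ ℕ λ k → k ≤ r × Walk G k x y

Code : Graph → Set₁
Code G = V G → Set

-- t-error-correcting: distinct codewords are at distance ≥ 2t+1,
-- i.e. not at distance ≤ 2t.
IsErrorCorrecting : (G : Graph) → ℕ → Code G → Set
IsErrorCorrecting G t D =
  ∀ x y → D x → D y → ¬ (x ≡ y) → ¬ DistLe G (2 * t) x y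

Covers : (G : Graph) → ℕ → Code G → Set
Covers G r D = ∀ v → Σ (V G) λ c → D c × DistLe G r v c

HasCoveringRadius : (G : Graph) → ℕ → Code G → Set
HasCoveringRadius G zero D = Covers G zero D
HasCoveringRadius G (suc r) D = Covers G (suc r) D × ¬ Covers G r D

IsQuasiPerfect : (G : Graph) → ℕ → Code G → Set
IsQuasiPerfect G t D = IsErrorCorrecting G t D × HasCoveringRadius G (suc t) D

-- A code in C_n □ C_n □ C_L is given by a closed walk ρ of length L in a small
-- digraph of "states" together with a pattern in C_n □ C_n for each state: layer c is the pattern of ρ(c).
-- A shift by d along the third cycle sends layer c to a layer whose state is reached from ρ(c) by d steps
-- forwards (or -d steps backwards) in the state digraph. Hence separation of codewords (distance ≥ 5),
-- covering within distance 3, and the existence of a point at distance 3 from the code can all be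
-- certified by a finite computation over the states, independently of L. For C_{6k} the states form a
-- directed 6-cycle. For C_{4k} with k ≥ 3 they form two cyclic blocks of 6 and 10 states with
-- transitions between the blocks, and a word is obtained by writing 4k as a sum of 6s and 10s.
-- The tori with third factor C_4 and C_8 get their own cyclic patterns.

module Submission where

open import Defs
open import Data.Nat using (ℕ; zero; suc; _+_; _*_; _∸_; _≤_; _<_; z≤n; s≤s; NonZero; _≡ᵇ_)
open import Data.Nat.Properties
  using (+-comm; +-assoc; +-suc; +-identityʳ; *-identityʳ; *-comm; *-distribˡ-+; ≤-trans; ≤-refl; ≤-pred; +-mono-≤;
         m+n≤o⇒m≤o; m+n≤o⇒m≤o∸n; m≤o∸n⇒m+n≤o; m≤n⇒m≤1+n; m≤n⇒m<n∨m≡n; m+[n∸m]≡n; ∸-monoˡ-≤)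
open import Data.Nat.DivMod using (_%_; m%n<n; m%n%n≡m%n; %-distribˡ-+; m<n⇒m%n≡m; n%n≡0; m*n%n≡0)
open import Data.Nat.GeneralisedArithmetic using (iterate)
open import Data.Nat.ListAction using (sum)
open import Data.Integer as ℤ using (ℤ; +_; -[1+_]; ∣_∣)
open import Data.Integer.Properties using (∣i+j∣≤∣i∣+∣j∣; suc-pred)
open import Data.Fin as Fin using (Fin; zero; suc; toℕ; fromℕ<; #_)
open import Data.Fin.Properties using (toℕ-injective; toℕ-fromℕ<; toℕ<n)
open import Data.Product using (Σ; _×_; _,_)
open import Data.Sum using (_⊎_; inj₁; inj₂; [_,_]′)
open import Data.Bool using (Bool; false; T; not; _∧_; _∨_)
open import Data.Bool.Properties using (T-∧; T-∨)
open import Data.Bool.ListAction using (all; any)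
open import Data.List using (List; []; _∷_; map; concatMap; allFin; upTo)
open import Data.List.NonEmpty as List⁺ using (List⁺; _∷_; _∷⁺_; toList)
open import Data.List.Membership.Propositional using (_∈_; find; lose)
open import Data.List.Membership.Propositional.Properties
  using (∈-allFin; ∈-upTo⁺; ∈-upTo⁻; ∈-map⁺; ∈-map⁻; ∈-concatMap⁺; ∈-concatMap⁻)
import Data.List.Membership.DecPropositional as DecMembership
open import Data.List.Relation.Unary.All as All using ()
open import Data.List.Relation.Unary.All.Properties using (all⁺)
open import Data.List.Relation.Unary.Any as Any using ()
open import Data.List.Relation.Unary.Any.Properties using (any⁻)
open import Data.Empty using (⊥-elim)
open import Data.Unit using (tt)
open import Relation.Nullary using (¬_)
open import Relation.Nullary.Decidable using (⌊_⌋; toWitness)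
open import Relation.Binary.PropositionalEquality
open import Function using (_∘_)
open import Function.Bundles using (Equivalence)

walk-iterate : ∀ {G} {f : V G → V G} → (∀ x → Adj G x (f x)) → ∀ n x → Walk G n x (iterate f x n)
walk-iterate adj zero x = here
walk-iterate {f = f} adj (suc n) x = step (adj x) (walk-iterate adj n (f x))

walk-++ : ∀ {G a b x y z} → Walk G a x y → Walk G b y z → Walk G (a + b) x z
walk-++ here w′ = w′
walk-++ (step e w) w′ = step e (walk-++ w w′)

module _ {G H : Graph} where

  walk-□ˡ : ∀ {k g g′ h} → Walk G k g g′ → Walk (G □ H) k (g , h) (g′ , h)
  walk-□ˡ here = here
  walk-□ˡ (step e w) = step (inj₁ (refl , e)) (walk-□ˡ w)

  walk-□ʳ : ∀ {k g h h′} → Walk H k h h′ → Walk (G □ H) k (g , h) (g , h′)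
  walk-□ʳ here = here
  walk-□ʳ (step e w) = step (inj₂ (refl , e)) (walk-□ʳ w)

  walk-□⁻ : ∀ {k g g′ h h′} → Walk (G □ H) k (g , h) (g′ , h′) →
            Σ ℕ λ k₁ → Σ ℕ λ k₂ → k₁ + k₂ ≡ k × Walk G k₁ g g′ × Walk H k₂ h h′
  walk-□⁻ here = 0 , 0 , refl , here , here
  walk-□⁻ (step (inj₁ (refl , e)) w) with walk-□⁻ w
  ... | k₁ , k₂ , refl , wG , wH = suc k₁ , k₂ , refl , step e wG , wH
  walk-□⁻ (step (inj₂ (refl , e)) w) with walk-□⁻ w
  ... | k₁ , k₂ , refl , wG , wH = k₁ , suc k₂ , +-suc k₁ k₂ , wG , step e wH

module _ {G : Graph} where

  vertex : ∀ {k x y} → Walk G k x y → ℕ → V G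
  vertex {x = x} here _ = x
  vertex {x = x} (step _ _) zero = x
  vertex (step _ w) (suc i) = vertex w i

  vertex-zero : ∀ {k x y} (w : Walk G k x y) → vertex w 0 ≡ x
  vertex-zero here = refl
  vertex-zero (step _ _) = refl

  vertex-end : ∀ {k x y} (w : Walk G k x y) → vertex w k ≡ y
  vertex-end here = refl
  vertex-end (step _ w) = vertex-end w

  vertex-step : ∀ {k x y} (w : Walk G k x y) {i} → i < k → Adj G (vertex w i) (vertex w (suc i))
  vertex-step (step {x = x} e w) {zero} _ = subst (Adj G x) (sym (vertex-zero w)) e
  vertex-step (step e w) {suc i} (s≤s i<k) = vertex-step w i<k

[m%n+o]%n≡[m+o]%n : ∀ m o n .{{_ : NonZero n}} → (m % n + o) % n ≡ (m + o) % n
[m%n+o]%n≡[m+o]%n m o n = begin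
  (m % n + o) % n               ≡⟨ %-distribˡ-+ (m % n) o n ⟩
  (m % n % n + o % n) % n       ≡⟨ cong (λ k → (k + o % n) % n) (m%n%n≡m%n m n) ⟩
  (m % n + o % n) % n           ≡⟨ %-distribˡ-+ m o n ⟨
  (m + o) % n                   ∎
  where open ≡-Reasoning

module _ {m : ℕ} where

  rotate : ℕ → Fin (suc m) → Fin (suc m)
  rotate n i = fromℕ< (m%n<n (toℕ i + n) (suc m))

  toℕ-rotate : ∀ n i → toℕ (rotate n i) ≡ (toℕ i + n) % suc m
  toℕ-rotate n i = toℕ-fromℕ< _

  rotate-zero : ∀ i → rotate 0 i ≡ i
  rotate-zero i = toℕ-injective (begin
    toℕ (rotate 0 i)       ≡⟨ toℕ-rotate 0 i ⟩
    (toℕ i + 0) % suc m    ≡⟨ cong (_% suc m) (+-identityʳ (toℕ i)) ⟩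
    toℕ i % suc m          ≡⟨ m<n⇒m%n≡m (toℕ<n i) ⟩
    toℕ i                  ∎)
    where open ≡-Reasoning

  rotate-+ : ∀ a b i → rotate b (rotate a i) ≡ rotate (a + b) i
  rotate-+ a b i = toℕ-injective (begin
    toℕ (rotate b (rotate a i))              ≡⟨ toℕ-rotate b (rotate a i) ⟩
    (toℕ (rotate a i) + b) % suc m           ≡⟨ cong (λ k → (k + b) % suc m) (toℕ-rotate a i) ⟩
    ((toℕ i + a) % suc m + b) % suc m        ≡⟨ [m%n+o]%n≡[m+o]%n (toℕ i + a) b (suc m) ⟩
    (toℕ i + a + b) % suc m                  ≡⟨ cong (_% suc m) (+-assoc (toℕ i) a b) ⟩
    (toℕ i + (a + b)) % suc m                ≡⟨ toℕ-rotate (a + b) i ⟨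
    toℕ (rotate (a + b) i)                   ∎)
    where open ≡-Reasoning

  rotate-cong : ∀ {a b} → a % suc m ≡ b % suc m → ∀ i → rotate a i ≡ rotate b i
  rotate-cong {a} {b} a≡b i = toℕ-injective (begin
    toℕ (rotate a i)                                ≡⟨ toℕ-rotate a i ⟩
    (toℕ i + a) % suc m                             ≡⟨ %-distribˡ-+ (toℕ i) a (suc m) ⟩
    (toℕ i % suc m + a % suc m) % suc m             ≡⟨ cong (λ k → (toℕ i % suc m + k) % suc m) a≡b ⟩
    (toℕ i % suc m + b % suc m) % suc m             ≡⟨ %-distribˡ-+ (toℕ i) b (suc m) ⟨
    (toℕ i + b) % suc m                             ≡⟨ toℕ-rotate b i ⟨
    toℕ (rotate b i)                                ∎)
    where open ≡-Reasoning

  rotate-multiple : ∀ k i → rotate (k * suc m) i ≡ i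
  rotate-multiple k i = trans (rotate-cong (m*n%n≡0 k (suc m)) i) (rotate-zero i)

  rotate-period : ∀ i → rotate (suc m) i ≡ i
  rotate-period i = trans (cong (λ n → rotate n i) (sym (+-identityʳ (suc m)))) (rotate-multiple 1 i)

  iterate-rotate : ∀ a n i → iterate (rotate a) i n ≡ rotate (n * a) i
  iterate-rotate a zero i = sym (rotate-zero i)
  iterate-rotate a (suc n) i = trans (iterate-rotate a n (rotate a i)) (rotate-+ a (n * a) i)

  next prev : Fin (suc m) → Fin (suc m)
  next = rotate 1
  prev = rotate m

  next-prev : ∀ i → next (prev i) ≡ i
  next-prev i = trans (rotate-+ m 1 i) (trans (cong (λ n → rotate n i) (+-comm m 1)) (rotate-period i))

  prev-next : ∀ i → prev (next i) ≡ i
  prev-next i = trans (rotate-+ 1 m i) (rotate-period i)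

  toℕ-next : ∀ i → toℕ (next i) ≡ suc (toℕ i) % suc m
  toℕ-next i = trans (toℕ-rotate 1 i) (cong (_% suc m) (+-comm (toℕ i) 1))

  CycleAdj-next : ∀ i → CycleAdj (suc m) i (next i)
  CycleAdj-next i = inj₁ (sym (toℕ-next i))

  CycleAdj-prev : ∀ i → CycleAdj (suc m) i (prev i)
  CycleAdj-prev i = inj₂ (trans (sym (toℕ-next (prev i))) (cong toℕ (next-prev i)))

  CycleAdj⇒next : ∀ {i j} → CycleAdj (suc m) i j → j ≡ next i ⊎ i ≡ next j
  CycleAdj⇒next {i} (inj₁ e) = inj₁ (toℕ-injective (trans (sym e) (sym (toℕ-next i))))
  CycleAdj⇒next {j = j} (inj₂ e) = inj₂ (toℕ-injective (trans (sym e) (sym (toℕ-next j))))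

  shift : ℤ → Fin (suc m) → Fin (suc m)
  shift (+ n) i = iterate next i n
  shift -[1+ n ] i = iterate prev i (suc n)

  shift-next : ∀ d i → shift d (next i) ≡ shift (ℤ.suc d) i
  shift-next (+ n) i = refl
  shift-next -[1+ zero ] i = prev-next i
  shift-next -[1+ suc n ] i = cong (λ j → iterate prev j (suc n)) (prev-next i)

  offset : ℤ → ℕ
  offset (+ n) = n
  offset -[1+ n ] = suc n * m

  toℕ-shift : ∀ d i → toℕ (shift d i) ≡ (toℕ i + offset d) % suc m
  toℕ-shift (+ n) i = begin
    toℕ (iterate next i n)     ≡⟨ cong toℕ (iterate-rotate 1 n i) ⟩
    toℕ (rotate (n * 1) i)     ≡⟨ toℕ-rotate (n * 1) i ⟩
    (toℕ i + n * 1) % suc m    ≡⟨ cong (λ k → (toℕ i + k) % suc m) (*-identityʳ n) ⟩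
    (toℕ i + n) % suc m        ∎
    where open ≡-Reasoning
  toℕ-shift -[1+ n ] i = trans (cong toℕ (iterate-rotate m (suc n) i)) (toℕ-rotate (suc n * m) i)

  shift-period : ∀ i → shift (+ suc m) i ≡ i
  shift-period i = begin
    iterate next i (suc m)      ≡⟨ iterate-rotate 1 (suc m) i ⟩
    rotate (suc m * 1) i        ≡⟨ cong (λ n → rotate n i) (*-identityʳ (suc m)) ⟩
    rotate (suc m) i            ≡⟨ rotate-period i ⟩
    i                           ∎
    where open ≡-Reasoning

  shift-period⁻ : ∀ i → shift -[1+ m ] i ≡ i
  shift-period⁻ i = begin
    iterate prev i (suc m)      ≡⟨ iterate-rotate m (suc m) i ⟩
    rotate (suc m * m) i        ≡⟨ cong (λ n → rotate n i) (*-comm (suc m) m) ⟩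
    rotate (m * suc m) i        ≡⟨ rotate-multiple m i ⟩
    i                           ∎
    where open ≡-Reasoning

  walk-shift : ∀ d (i : Fin (suc m)) → Walk (Cycle (suc m)) ∣ d ∣ i (shift d i)
  walk-shift (+ n) = walk-iterate CycleAdj-next n
  walk-shift -[1+ n ] = walk-iterate CycleAdj-prev (suc n)

  walk⇒shift : ∀ {k i j} → Walk (Cycle (suc m)) k i j → Σ ℤ λ d → ∣ d ∣ ≤ k × j ≡ shift d i
  walk⇒shift here = + 0 , z≤n , refl
  walk⇒shift {i = i} (step i~i′ w) with walk⇒shift w | CycleAdj⇒next i~i′
  ... | d , ∣d∣≤k , refl | inj₁ refl =
    ℤ.suc d , ≤-trans (∣i+j∣≤∣i∣+∣j∣ (+ 1) d) (s≤s ∣d∣≤k) , shift-next d i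
  ... | d , ∣d∣≤k , refl | inj₂ refl =
    ℤ.pred d , ≤-trans (∣i+j∣≤∣i∣+∣j∣ -[1+ 0 ] d) (s≤s ∣d∣≤k) ,
    trans (cong (λ e → shift e _) (sym (suc-pred d))) (sym (shift-next (ℤ.pred d) _))

module _ {G : Graph} where

  closedWalk-next : ∀ {l x} (w : Walk G (suc l) x x) (c : Fin (suc l)) →
                    Adj G (vertex w (toℕ c)) (vertex w (toℕ (next c)))
  closedWalk-next {l} {x} w c = subst (Adj G _) wraps (vertex-step w (toℕ<n c))
    where
    next-last : toℕ c ≡ l → toℕ (next c) ≡ 0
    next-last c≡l = trans (toℕ-next c) (trans (cong (λ n → suc n % suc l) c≡l) (n%n≡0 (suc l)))
    wraps : vertex w (suc (toℕ c)) ≡ vertex w (toℕ (next c))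
    wraps with m≤n⇒m<n∨m≡n (≤-pred (toℕ<n c))
    ... | inj₁ c<l = cong (vertex w) (sym (trans (toℕ-next c) (m<n⇒m%n≡m (s≤s c<l))))
    ... | inj₂ c≡l = begin
      vertex w (suc (toℕ c))   ≡⟨ cong (vertex w ∘ suc) c≡l ⟩
      vertex w (suc l)         ≡⟨ vertex-end w ⟩
      x                        ≡⟨ vertex-zero w ⟨
      vertex w 0               ≡⟨ cong (vertex w) (next-last c≡l) ⟨
      vertex w (toℕ (next c))  ∎
      where open ≡-Reasoning

Torus : ℕ → ℕ → Graph
Torus m l = Cycle (suc m) □ Cycle (suc m) □ Cycle (suc l)

Shift : Set
Shift = (ℤ × ℤ) × ℤ

∥_∥ : Shift → ℕ
∥ (a , b) , d ∥ = ∣ a ∣ + ∣ b ∣ + ∣ d ∣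

module _ {m l : ℕ} where

  shift³ : Shift → V (Torus m l) → V (Torus m l)
  shift³ ((a , b) , d) ((x , y) , c) = (shift a x , shift b y) , shift d c

  walk-shift³ : ∀ o v → Walk (Torus m l) ∥ o ∥ v (shift³ o v)
  walk-shift³ ((a , b) , d) ((x , y) , c) =
    walk-++ (walk-□ˡ (walk-++ (walk-□ˡ (walk-shift a x)) (walk-□ʳ (walk-shift b y)))) (walk-□ʳ (walk-shift d c))

  walk⇒shift³ : ∀ {k v w} → Walk (Torus m l) k v w → Σ Shift λ o → ∥ o ∥ ≤ k × w ≡ shift³ o v
  walk⇒shift³ w with walk-□⁻ w
  ... | _ , _ , refl , wxy , wc with walk-□⁻ wxy
  ... | _ , _ , refl , wx , wy with walk⇒shift wx | walk⇒shift wy | walk⇒shift wc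
  ... | a , a≤ , refl | b , b≤ , refl | d , d≤ , refl = ((a , b) , d) , +-mono-≤ (+-mono-≤ a≤ b≤) d≤ , refl

ints : ℕ → List ℤ
ints zero = + 0 ∷ []
ints (suc r) = + suc r ∷ -[1+ r ] ∷ ints r

∈-ints : ∀ {r z} → ∣ z ∣ ≤ r → z ∈ ints r
∈-ints {zero} {+ zero} _ = Any.here refl
∈-ints {suc r} {+ n} n≤1+r with m≤n⇒m<n∨m≡n n≤1+r
... | inj₁ n<1+r = Any.there (Any.there (∈-ints (≤-pred n<1+r)))
... | inj₂ refl = Any.here refl
∈-ints {suc r} { -[1+ n ]} n<1+r with m≤n⇒m<n∨m≡n n<1+r
... | inj₁ 1+n<1+r = Any.there (Any.there (∈-ints (≤-pred 1+n<1+r)))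
... | inj₂ refl = Any.there (Any.here refl)

ints-bounded : ∀ {r z} → z ∈ ints r → ∣ z ∣ ≤ r
ints-bounded {zero} (Any.here refl) = z≤n
ints-bounded {suc r} (Any.here refl) = ≤-refl
ints-bounded {suc r} (Any.there (Any.here refl)) = ≤-refl
ints-bounded {suc r} (Any.there (Any.there z∈)) = m≤n⇒m≤1+n (ints-bounded z∈)

shiftsAt : ℕ → ℤ → ℤ → List Shift
shiftsAt r a b = map ((a , b) ,_) (ints (r ∸ (∣ a ∣ + ∣ b ∣)))

shiftsFrom : ℕ → ℤ → List Shift
shiftsFrom r a = concatMap (shiftsAt r a) (ints (r ∸ ∣ a ∣))

shifts : ℕ → List Shift
shifts r = concatMap (shiftsFrom r) (ints r)

∈-shifts : ∀ {r} o → ∥ o ∥ ≤ r → o ∈ shifts r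
∈-shifts {r} ((a , b) , d) ∥o∥≤r =
  ∈-concatMap⁺ (shiftsFrom r) (lose {x = a} (∈-ints ∣a∣≤r)
    (∈-concatMap⁺ (shiftsAt r a) (lose {x = b} (∈-ints ∣b∣≤) (∈-map⁺ _ (∈-ints ∣d∣≤)))))
  where
  ∣a∣+∣b∣≤r : ∣ a ∣ + ∣ b ∣ ≤ r
  ∣a∣+∣b∣≤r = m+n≤o⇒m≤o _ ∥o∥≤r
  ∣a∣≤r : ∣ a ∣ ≤ r
  ∣a∣≤r = m+n≤o⇒m≤o _ ∣a∣+∣b∣≤r
  ∣b∣≤ : ∣ b ∣ ≤ r ∸ ∣ a ∣
  ∣b∣≤ = m+n≤o⇒m≤o∸n ∣ b ∣ (subst (_≤ r) (+-comm ∣ a ∣ ∣ b ∣) ∣a∣+∣b∣≤r)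
  ∣d∣≤ : ∣ d ∣ ≤ r ∸ (∣ a ∣ + ∣ b ∣)
  ∣d∣≤ = m+n≤o⇒m≤o∸n ∣ d ∣ (subst (_≤ r) (+-comm (∣ a ∣ + ∣ b ∣) ∣ d ∣) ∥o∥≤r)

shifts-bounded : ∀ {r o} → o ∈ shifts r → ∥ o ∥ ≤ r
shifts-bounded {r} o∈ with find (∈-concatMap⁻ (shiftsFrom r) {ints r} o∈)
... | a , a∈ , o∈ₐ with find (∈-concatMap⁻ (shiftsAt r a) {ints (r ∸ ∣ a ∣)} o∈ₐ)
... | b , b∈ , o∈ₐ₊ with ∈-map⁻ ((a , b) ,_) o∈ₐ₊
... | d , d∈ , refl = subst (_≤ r) (+-comm ∣ d ∣ _) (m≤o∸n⇒m+n≤o ∣ d ∣ ∣a∣+∣b∣≤r (ints-bounded d∈))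
  where
  ∣a∣+∣b∣≤r : ∣ a ∣ + ∣ b ∣ ≤ r
  ∣a∣+∣b∣≤r = subst (_≤ r) (+-comm ∣ b ∣ ∣ a ∣) (m≤o∸n⇒m+n≤o ∣ b ∣ (ints-bounded a∈) (ints-bounded b∈))

T-not⇒¬T : ∀ {b} → T (not b) → ¬ T b
T-not⇒¬T {false} _ ()

module _ {A : Set} (p : A → Bool) where

  all-∈ : ∀ {xs} → T (all p xs) → ∀ {x} → x ∈ xs → T (p x)
  all-∈ {xs} t = All.lookup (all⁺ p xs t)

  any-∈ : ∀ {xs} → T (any p xs) → Σ A λ x → x ∈ xs × T (p x)
  any-∈ {xs} t = find (any⁻ p xs t)

States : ∀ {S} → (Fin S → List (Fin S)) → Graph
States {S} succs = record { V = Fin S ; Adj = λ s t → t ∈ succs s }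

module _ {S : ℕ} where

  reach : (Fin S → List (Fin S)) → ℕ → Fin S → List (Fin S)
  reach nexts zero s = s ∷ []
  reach nexts (suc n) s = concatMap (reach nexts n) (nexts s)

  reach-iterate : ∀ {A : Set} (ρ : A → Fin S) (f : A → A) nexts →
                  (∀ c → ρ (f c) ∈ nexts (ρ c)) → ∀ n c → ρ (iterate f c n) ∈ reach nexts n (ρ c)
  reach-iterate ρ f nexts ρ-step zero c = Any.here refl
  reach-iterate ρ f nexts ρ-step (suc n) c =
    ∈-concatMap⁺ (reach nexts n) (lose (ρ-step c) (reach-iterate ρ f nexts ρ-step n (f c)))

HasQuasiPerfectCode : ℕ → Graph → Set₁
HasQuasiPerfectCode t G = Σ (Code G) λ D → IsQuasiPerfect G t D

-- Shifts (0 , 0 , d) with d ∈ periods are exempt from the separation check, so each such d must act as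
-- the identity on the third cycle; only the torus with third factor C_4 needs a period other than 0.
module LayeredCode {m S : ℕ} (succs preds : Fin S → List (Fin S))
                   (layer : Fin S → ℕ → ℕ → Bool) (periods : List ℤ) where

  open DecMembership (Fin._≟_ {S}) using (_∈?_)
  open DecMembership ℤ._≟_ using () renaming (_∈?_ to _∈ℤ?_)

  targets : ℤ → Fin S → List (Fin S)
  targets (+ n) = reach succs n
  targets -[1+ n ] = reach preds (suc n)

  move : ℤ → ℕ → ℕ
  move d x = (x + offset {m} d) % suc m

  missesᵇ hitsᵇ : Fin S → ℕ → ℕ → Shift → Bool
  missesᵇ s x y ((a , b) , d) = all (λ t → not (layer t (move a x) (move b y))) (targets d s)
  hitsᵇ s x y ((a , b) , d) = all (λ t → layer t (move a x) (move b y)) (targets d s)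

  periodᵇ : Shift → Bool
  periodᵇ ((a , b) , d) = ⌊ a ℤ.≟ + 0 ⌋ ∧ ⌊ b ℤ.≟ + 0 ⌋ ∧ ⌊ d ∈ℤ? periods ⌋

  safeᵇ : Fin S → ℕ → ℕ → Shift → Bool
  safeᵇ s x y o = missesᵇ s x y o ∨ periodᵇ o

  separatedAtᵇ coveredAtᵇ isolatedAtᵇ : Fin S → ℕ → ℕ → Bool
  separatedAtᵇ s x y = not (layer s x y) ∨ all (safeᵇ s x y) (shifts 4)
  coveredAtᵇ s x y = any (hitsᵇ s x y) (shifts 3)
  isolatedAtᵇ s x y = all (missesᵇ s x y) (shifts 2)

  everyPointᵇ : (Fin S → ℕ → ℕ → Bool) → Bool
  everyPointᵇ p = all (λ s → all (λ x → all (p s x) (upTo (suc m))) (upTo (suc m))) (allFin S)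

  everyPoint : ∀ p → T (everyPointᵇ p) → ∀ s (x y : Fin (suc m)) → T (p s (toℕ x) (toℕ y))
  everyPoint p t s x y =
    all-∈ (p s (toℕ x)) (all-∈ (λ x → all (p s x) (upTo (suc m)))
      (all-∈ (λ s → all (λ x → all (p s x) (upTo (suc m))) (upTo (suc m))) t (∈-allFin s))
      (∈-upTo⁺ (toℕ<n x))) (∈-upTo⁺ (toℕ<n y))

  somePointᵇ : (Fin S → ℕ → ℕ → Bool) → Fin S → Bool
  somePointᵇ p s = any (λ x → any (p s x) (upTo (suc m))) (upTo (suc m))

  somePoint : ∀ p s → T (somePointᵇ p s) → Σ (Fin (suc m)) λ x → Σ (Fin (suc m)) λ y → T (p s (toℕ x) (toℕ y))
  somePoint p s t = row (any-∈ (λ x → any (p s x) (upTo (suc m))) {upTo (suc m)} t)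
    where
    row : Σ ℕ (λ x → x ∈ upTo (suc m) × T (any (p s x) (upTo (suc m)))) →
          Σ (Fin (suc m)) λ x → Σ (Fin (suc m)) λ y → T (p s (toℕ x) (toℕ y))
    row (x , x∈ , t′) with any-∈ (p s x) {upTo (suc m)} t′
    ... | y , y∈ , pxy =
      fromℕ< (∈-upTo⁻ x∈) , fromℕ< (∈-upTo⁻ y∈) ,
      subst₂ (λ x y → T (p s x y)) (sym (toℕ-fromℕ< (∈-upTo⁻ x∈))) (sym (toℕ-fromℕ< (∈-upTo⁻ y∈))) pxy

  predsᵇ certifiedᵇ : Bool
  predsᵇ = all (λ t → all (λ s → ⌊ t ∈? preds s ⌋) (succs t)) (allFin S)
  certifiedᵇ = predsᵇ ∧ everyPointᵇ separatedAtᵇ ∧ everyPointᵇ coveredAtᵇ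

  uncoveredᵇ : Fin S → Bool
  uncoveredᵇ = somePointᵇ isolatedAtᵇ

  module _ {l : ℕ} {s₀ : Fin S} (word : Walk (States succs) (suc l) s₀ s₀)
           (periodic : ∀ {d} → d ∈ periods → ∀ (c : Fin (suc l)) → shift d c ≡ c)
           (preds-ok : T predsᵇ) where

    ρ : Fin (suc l) → Fin S
    ρ c = vertex word (toℕ c)

    code : Code (Torus m l)
    code ((x , y) , c) = T (layer (ρ c) (toℕ x) (toℕ y))

    code-shift³ : ∀ a b d x y c → code (shift³ ((a , b) , d) ((x , y) , c)) ≡
                                  T (layer (ρ (shift d c)) (move a (toℕ x)) (move b (toℕ y)))
    code-shift³ a b d x y c = cong₂ (λ x′ y′ → T (layer (ρ (shift d c)) x′ y′)) (toℕ-shift a x) (toℕ-shift b y)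

    ρ-next : ∀ c → ρ (next c) ∈ succs (ρ c)
    ρ-next = closedWalk-next word

    ρ-prev : ∀ c → ρ (prev c) ∈ preds (ρ c)
    ρ-prev c = toWitness (all-∈ (λ s → ⌊ ρ (prev c) ∈? preds s ⌋)
                            (all-∈ (λ t → all (λ s → ⌊ t ∈? preds s ⌋) (succs t)) preds-ok (∈-allFin (ρ (prev c))))
                            ρc∈)
      where
      ρc∈ : ρ c ∈ succs (ρ (prev c))
      ρc∈ = subst (λ c′ → ρ c′ ∈ succs (ρ (prev c))) (next-prev c) (ρ-next (prev c))

    ρ-shift : ∀ d c → ρ (shift d c) ∈ targets d (ρ c)
    ρ-shift (+ n) = reach-iterate ρ next succs ρ-next n
    ρ-shift -[1+ n ] = reach-iterate ρ prev preds ρ-prev (suc n)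

    period-sound : ∀ o (v : V (Torus m l)) → T (periodᵇ o) → shift³ o v ≡ v
    period-sound ((a , b) , d) ((x , y) , c) t
      with Equivalence.to T-∧ t
    ... | a≟0 , t′ with Equivalence.to T-∧ t′
    ... | b≟0 , d∈ with toWitness {a? = a ℤ.≟ + 0} a≟0 | toWitness {a? = b ℤ.≟ + 0} b≟0
    ... | refl | refl = cong ((x , y) ,_) (periodic (toWitness d∈) c)

    misses-sound : ∀ o x y c → T (missesᵇ (ρ c) (toℕ x) (toℕ y) o) → ¬ code (shift³ o ((x , y) , c))
    misses-sound ((a , b) , d) x y c t rewrite code-shift³ a b d x y c =
      T-not⇒¬T (all-∈ (λ t → not (layer t (move a (toℕ x)) (move b (toℕ y)))) t (ρ-shift d c))

    hits-sound : ∀ o x y c → T (hitsᵇ (ρ c) (toℕ x) (toℕ y) o) → code (shift³ o ((x , y) , c))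
    hits-sound ((a , b) , d) x y c t rewrite code-shift³ a b d x y c =
      all-∈ (λ t → layer t (move a (toℕ x)) (move b (toℕ y))) t (ρ-shift d c)

    separatedAt-sound : ∀ x y c → T (separatedAtᵇ (ρ c) (toℕ x) (toℕ y)) → code ((x , y) , c) →
                        ∀ o → ∥ o ∥ ≤ 4 → code (shift³ o ((x , y) , c)) → shift³ o ((x , y) , c) ≡ ((x , y) , c)
    separatedAt-sound x y c ok v∈ o ∥o∥≤4 w∈ =
      [ (λ v∉ → ⊥-elim (T-not⇒¬T v∉ v∈)) , near ]′ (Equivalence.to T-∨ ok)
      where
      near : T (all (safeᵇ (ρ c) (toℕ x) (toℕ y)) (shifts 4)) → shift³ o ((x , y) , c) ≡ ((x , y) , c)
      near t = [ (λ misses → ⊥-elim (misses-sound o x y c misses w∈)) , period-sound o _ ]′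
                 (Equivalence.to T-∨ (all-∈ (safeᵇ (ρ c) (toℕ x) (toℕ y)) {shifts 4} t (∈-shifts o ∥o∥≤4)))

    coveredAt-sound : ∀ x y c → T (coveredAtᵇ (ρ c) (toℕ x) (toℕ y)) →
                      Σ (V (Torus m l)) λ w → code w × DistLe (Torus m l) 3 ((x , y) , c) w
    coveredAt-sound x y c ok =
      let o , o∈ , hits = any-∈ (hitsᵇ (ρ c) (toℕ x) (toℕ y)) {shifts 3} ok
      in shift³ o ((x , y) , c) , hits-sound o x y c hits , ∥ o ∥ , shifts-bounded {3} o∈ , walk-shift³ o ((x , y) , c)

    isolatedAt-sound : ∀ x y c → T (isolatedAtᵇ (ρ c) (toℕ x) (toℕ y)) →
                       ∀ o → ∥ o ∥ ≤ 2 → ¬ code (shift³ o ((x , y) , c))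
    isolatedAt-sound x y c ok o ∥o∥≤2 =
      misses-sound o x y c (all-∈ (missesᵇ (ρ c) (toℕ x) (toℕ y)) {shifts 2} ok (∈-shifts o ∥o∥≤2))

    separated : T (everyPointᵇ separatedAtᵇ) → IsErrorCorrecting (Torus m l) 2 code
    separated ok ((x , y) , c) w v∈ w∈ v≢w (k , k≤4 , walk) with walk⇒shift³ walk
    ... | o , ∥o∥≤k , refl =
      v≢w (sym (separatedAt-sound x y c (everyPoint separatedAtᵇ ok (ρ c) x y) v∈ o (≤-trans ∥o∥≤k k≤4) w∈))

    covered : T (everyPointᵇ coveredAtᵇ) → Covers (Torus m l) 3 code
    covered ok ((x , y) , c) = coveredAt-sound x y c (everyPoint coveredAtᵇ ok (ρ c) x y)

    isolated⇒uncovered : ∀ x y c → T (isolatedAtᵇ (ρ c) (toℕ x) (toℕ y)) → ¬ Covers (Torus m l) 2 code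
    isolated⇒uncovered x y c ok covers with covers ((x , y) , c)
    ... | w , w∈ , k , k≤2 , walk with walk⇒shift³ walk
    ... | o , ∥o∥≤k , refl = isolatedAt-sound x y c ok o (≤-trans ∥o∥≤k k≤2) w∈

    uncovered : ∀ c₀ → T (uncoveredᵇ (ρ c₀)) → ¬ Covers (Torus m l) 2 code
    uncovered c₀ ok = let x , y , isolated = somePoint isolatedAtᵇ (ρ c₀) ok in isolated⇒uncovered x y c₀ isolated

  layeredCode : T certifiedᵇ → ∀ {l s₀} → Walk (States succs) (suc l) s₀ s₀ → T (uncoveredᵇ s₀) →
                (∀ {d} → d ∈ periods → ∀ (c : Fin (suc l)) → shift d c ≡ c) →
                HasQuasiPerfectCode 2 (Torus m l)
  layeredCode ok word s₀-ok periodic with Equivalence.to T-∧ ok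
  ... | preds-ok , ok′ with Equivalence.to T-∧ ok′
  ... | separated-ok , covering-ok =
    code word periodic preds-ok ,
    separated word periodic preds-ok separated-ok ,
    covered word periodic preds-ok covering-ok ,
    uncovered word periodic preds-ok zero (subst (T ∘ uncoveredᵇ) (sym (vertex-zero word)) s₀-ok)

zero-period : ∀ {l d} → d ∈ + 0 ∷ [] → ∀ (c : Fin (suc l)) → shift d c ≡ c
zero-period (Any.here refl) c = refl

cyclicSuccs cyclicPreds : ∀ {p} → Fin (suc p) → List (Fin (suc p))
cyclicSuccs s = next s ∷ []
cyclicPreds s = prev s ∷ []

laps : ∀ {p} k (s : Fin (suc p)) → Walk (States cyclicSuccs) (k * suc p) s s
laps zero s = here
laps {p} (suc k) s =
  walk-++ (subst (Walk _ (suc p) s) (shift-period s) (walk-iterate (λ _ → Any.here refl) (suc p) s)) (laps k s)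

infix 4 _∈ᵇ_
_∈ᵇ_ : ℕ → List ℕ → Bool
v ∈ᵇ vs = any (v ≡ᵇ_) vs

linearLayer : ∀ {S} (n : ℕ) .{{_ : NonZero n}} (a : ℕ) → (ℕ → List ℕ) → Fin S → ℕ → ℕ → Bool
linearLayer n a residues s x y = (x + a * y) % n ∈ᵇ residues (toℕ s)

listedLayer : ∀ {S} (n : ℕ) → (ℕ → List ℕ) → Fin S → ℕ → ℕ → Bool
listedLayer n points s x y = x * n + y ∈ᵇ points (toℕ s)

sixfoldCode : ∀ {m} (layer : Fin 6 → ℕ → ℕ → Bool) →
              let open LayeredCode {m} cyclicSuccs cyclicPreds layer (+ 0 ∷ []) in
              T certifiedᵇ → T (uncoveredᵇ zero) →
              ∀ k → 1 ≤ k → HasQuasiPerfectCode 2 (Cycle (suc m) □ Cycle (suc m) □ Cycle (6 * k))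
sixfoldCode {m} layer ok ok₀ (suc k) _ =
  subst (λ L → HasQuasiPerfectCode 2 (Cycle (suc m) □ Cycle (suc m) □ Cycle L)) (*-comm (suc k) 6)
        (layeredCode ok (laps (suc k) zero) ok₀ zero-period)
  where open LayeredCode {m} cyclicSuccs cyclicPreds layer (+ 0 ∷ [])

residues14 residues15 residues18 : ℕ → List ℕ
residues14 0 = 0 ∷ []
residues14 3 = 3 ∷ []
residues14 _ = []
residues15 0 = 0 ∷ []
residues15 3 = 5 ∷ []
residues15 _ = []
residues18 0 = 0 ∷ []
residues18 2 = 6 ∷ []
residues18 4 = 12 ∷ []
residues18 _ = []

points16 points17 points19 : ℕ → List ℕ
points16 0 = 0 ∷ 8 ∷ 68 ∷ 76 ∷ 128 ∷ 136 ∷ 196 ∷ 204 ∷ []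
points16 1 = 21 ∷ 29 ∷ 81 ∷ 89 ∷ 149 ∷ 157 ∷ 209 ∷ 217 ∷ []
points16 3 = 34 ∷ 42 ∷ 102 ∷ 110 ∷ 162 ∷ 170 ∷ 230 ∷ 238 ∷ []
points16 4 = 55 ∷ 63 ∷ 115 ∷ 123 ∷ 183 ∷ 191 ∷ 243 ∷ 251 ∷ []
points16 _ = []
points17 0 = 1 ∷ 6 ∷ 48 ∷ 93 ∷ 103 ∷ 114 ∷ 170 ∷ 194 ∷ 200 ∷ 207 ∷ 231 ∷ []
points17 1 = 56 ∷ 61 ∷ 84 ∷ 125 ∷ 162 ∷ 238 ∷ 243 ∷ 285 ∷ []
points17 2 = 36 ∷ 149 ∷ 155 ∷ 235 ∷ 280 ∷ []
points17 3 = 11 ∷ 16 ∷ 75 ∷ 99 ∷ 106 ∷ 112 ∷ 119 ∷ 192 ∷ 203 ∷ 213 ∷ 258 ∷ []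
points17 4 = 21 ∷ 51 ∷ 63 ∷ 144 ∷ 181 ∷ 222 ∷ 245 ∷ 250 ∷ []
points17 5 = 26 ∷ 71 ∷ 151 ∷ 157 ∷ 270 ∷ []
points17 _ = []
points19 0 = 7 ∷ 53 ∷ 58 ∷ 99 ∷ 104 ∷ 151 ∷ 185 ∷ 199 ∷ 213 ∷ 263 ∷ 296 ∷ 306 ∷ 340 ∷ []
points19 1 = 3 ∷ 37 ∷ 63 ∷ 68 ∷ 145 ∷ 173 ∷ 227 ∷ 255 ∷ 310 ∷ 356 ∷ []
points19 2 = 95 ∷ 109 ∷ 159 ∷ 241 ∷ 269 ∷ 351 ∷ []
points19 3 = 12 ∷ 40 ∷ 74 ∷ 84 ∷ 117 ∷ 167 ∷ 181 ∷ 195 ∷ 229 ∷ 276 ∷ 281 ∷ 322 ∷ 327 ∷ []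
points19 4 = 16 ∷ 24 ∷ 70 ∷ 125 ∷ 153 ∷ 207 ∷ 235 ∷ 312 ∷ 317 ∷ 343 ∷ []
points19 5 = 29 ∷ 111 ∷ 139 ∷ 221 ∷ 266 ∷ 271 ∷ []
points19 _ = []

sixfoldCodes : ∀ k → 1 ≤ k → ∀ i → i ≤ 5 →
                      HasQuasiPerfectCode 2 (Cycle (14 + i) □ Cycle (14 + i) □ Cycle (6 * k))
sixfoldCodes k 1≤k 0 _ = sixfoldCode (linearLayer 14 10 residues14) tt tt k 1≤k
sixfoldCodes k 1≤k 1 _ = sixfoldCode (linearLayer 15 11 residues15) tt tt k 1≤k
sixfoldCodes k 1≤k 2 _ = sixfoldCode (listedLayer 16 points16) tt tt k 1≤k
sixfoldCodes k 1≤k 3 _ = sixfoldCode (listedLayer 17 points17) tt tt k 1≤k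
sixfoldCodes k 1≤k 4 _ = sixfoldCode (linearLayer 18 14 residues18) tt tt k 1≤k
sixfoldCodes k 1≤k 5 _ = sixfoldCode (listedLayer 19 points19) tt tt k 1≤k
sixfoldCodes k _ (suc (suc (suc (suc (suc (suc _)))))) (s≤s (s≤s (s≤s (s≤s (s≤s ())))))

residues4 : ℕ → List ℕ
residues4 0 = 1 ∷ []
residues4 2 = 8 ∷ []
residues4 _ = []

code₄ : HasQuasiPerfectCode 2 (Cycle 14 □ Cycle 14 □ Cycle 4)
code₄ = layeredCode tt (laps 1 (# 1)) tt periodic
  where
  open LayeredCode {13} cyclicSuccs cyclicPreds (linearLayer 14 10 residues4) (+ 0 ∷ + 4 ∷ -[1+ 3 ] ∷ [])
  periodic : ∀ {d} → d ∈ + 0 ∷ + 4 ∷ -[1+ 3 ] ∷ [] → ∀ (c : Fin 4) → shift d c ≡ c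
  periodic (Any.here refl) c = refl
  periodic (Any.there (Any.here refl)) = shift-period
  periodic (Any.there (Any.there (Any.here refl))) = shift-period⁻

points8 : ℕ → List ℕ
points8 0 = 21 ∷ 60 ∷ 65 ∷ 99 ∷ 105 ∷ 130 ∷ 150 ∷ []
points8 1 = 15 ∷ 69 ∷ 186 ∷ []
points8 2 = 24 ∷ 48 ∷ 87 ∷ 123 ∷ 141 ∷ 162 ∷ 195 ∷ []
points8 3 = 93 ∷ 132 ∷ []
points8 4 = 6 ∷ 30 ∷ 54 ∷ 84 ∷ 165 ∷ 171 ∷ []
points8 5 = 0 ∷ 50 ∷ 75 ∷ 115 ∷ 120 ∷ []
points8 6 = 18 ∷ 57 ∷ 95 ∷ 139 ∷ 160 ∷ 191 ∷ []
points8 7 = 39 ∷ 156 ∷ 180 ∷ []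
points8 _ = []

code₈ : HasQuasiPerfectCode 2 (Cycle 14 □ Cycle 14 □ Cycle 8)
code₈ = layeredCode tt (laps 1 zero) tt zero-period
  where open LayeredCode {13} cyclicSuccs cyclicPreds (listedLayer 14 points8) (+ 0 ∷ [])

jumps jumpsBack : ℕ → List (Fin 16)
jumps 5 = # 0 ∷ []
jumps 15 = # 6 ∷ []
jumps _ = []
jumpsBack 0 = # 5 ∷ []
jumpsBack 6 = # 15 ∷ []
jumpsBack _ = []

-- States 0–5 and 6–15 form the two blocks. The jumps 5 → 0 and 15 → 6 close each block into a cycle,
-- while next passes from 5 to 6 and from 15 to 0, into the other block.
blockSuccs blockPreds : Fin 16 → List (Fin 16)
blockSuccs s = next s ∷ jumps (toℕ s)
blockPreds s = prev s ∷ jumpsBack (toℕ s)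

data Block : Set where
  B₆ B₁₀ : Block

blockSize : Block → ℕ
blockSize B₆ = 6
blockSize B₁₀ = 10

entry second : Block → Fin 16
entry B₆ = # 0
entry B₁₀ = # 6
second B₆ = # 1
second B₁₀ = # 7

-- Words start at the second layer of their first block: states 1 and 7 carry a point at distance 3
-- from the code, the block entries 0 and 6 do not.
blockWalk : ∀ b b′ → Walk (States blockSuccs) (blockSize b) (second b) (second b′)
blockWalk B₆ b′ = walk-++ (walk-iterate (λ _ → Any.here refl) 4 (# 1)) (step (exit₅ b′) (step (enter b′) here))
  where
  exit₅ : ∀ b′ → entry b′ ∈ blockSuccs (# 5)
  exit₅ B₆ = Any.there (Any.here refl)
  exit₅ B₁₀ = Any.here refl
  enter : ∀ b′ → second b′ ∈ blockSuccs (entry b′)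
  enter B₆ = Any.here refl
  enter B₁₀ = Any.here refl
blockWalk B₁₀ b′ = walk-++ (walk-iterate (λ _ → Any.here refl) 8 (# 7)) (step (exit₁₅ b′) (step (enter b′) here))
  where
  exit₁₅ : ∀ b′ → entry b′ ∈ blockSuccs (# 15)
  exit₁₅ B₆ = Any.here refl
  exit₁₅ B₁₀ = Any.there (Any.here refl)
  enter : ∀ b′ → second b′ ∈ blockSuccs (entry b′)
  enter B₆ = Any.here refl
  enter B₁₀ = Any.here refl

blocksWalk : ∀ b bs b′ → Walk (States blockSuccs) (sum (map blockSize (b ∷ bs))) (second b) (second b′)
blocksWalk b [] b′ = walk-++ (blockWalk b b′) here
blocksWalk b (c ∷ bs) b′ = walk-++ (blockWalk b c) (blocksWalk c bs b′)

blocks : ℕ → List⁺ Block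
blocks 0 = B₆ ∷ B₆ ∷ []
blocks 1 = B₆ ∷ B₁₀ ∷ []
blocks 2 = B₁₀ ∷ B₁₀ ∷ []
blocks (suc (suc (suc j))) = B₆ ∷⁺ B₆ ∷⁺ blocks j

blocks-size : ∀ j → sum (map blockSize (toList (blocks j))) ≡ 4 * (3 + j)
blocks-size 0 = refl
blocks-size 1 = refl
blocks-size 2 = refl
blocks-size (suc (suc (suc j))) = trans (cong (λ n → 12 + n) (blocks-size j)) (sym (*-distribˡ-+ 4 3 (3 + j)))

residuesBlocks : ℕ → List ℕ
residuesBlocks 0 = 0 ∷ []
residuesBlocks 3 = 3 ∷ []
residuesBlocks 6 = 0 ∷ []
residuesBlocks 9 = 3 ∷ []
residuesBlocks 11 = 10 ∷ []
residuesBlocks 14 = 7 ∷ []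
residuesBlocks _ = []

module BlockCode = LayeredCode {13} blockSuccs blockPreds (linearLayer 14 10 residuesBlocks) (+ 0 ∷ [])

second-uncovered : ∀ b → T (BlockCode.uncoveredᵇ (second b))
second-uncovered B₆ = tt
second-uncovered B₁₀ = tt

blockCode : ∀ j → HasQuasiPerfectCode 2 (Cycle 14 □ Cycle 14 □ Cycle (4 * (3 + j)))
blockCode j = BlockCode.layeredCode tt word (second-uncovered b) zero-period
  where
  b = List⁺.head (blocks j)
  word : Walk (States blockSuccs) (4 * (3 + j)) (second b) (second b)
  word = subst (λ L → Walk (States blockSuccs) L (second b) (second b)) (blocks-size j) (blocksWalk b (List⁺.tail (blocks j)) b)

theorem11 : (k : ℕ) → 1 ≤ k →
    (Σ (Code (Cycle 14 □ Cycle 14 □ Cycle (4 * k))) λ D →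
        IsQuasiPerfect (Cycle 14 □ Cycle 14 □ Cycle (4 * k)) 2 D)
    × ((n : ℕ) → 14 ≤ n → n ≤ 19 →
        Σ (Code (Cycle n □ Cycle n □ Cycle (6 * k))) λ D →
          IsQuasiPerfect (Cycle n □ Cycle n □ Cycle (6 * k)) 2 D)
theorem11 k 1≤k = fourfold k 1≤k , sixfold
  where
  fourfold : ∀ k → 1 ≤ k → HasQuasiPerfectCode 2 (Cycle 14 □ Cycle 14 □ Cycle (4 * k))
  fourfold 1 _ = code₄
  fourfold 2 _ = code₈
  fourfold (suc (suc (suc j))) _ = blockCode j
  sixfold : ∀ n → 14 ≤ n → n ≤ 19 → HasQuasiPerfectCode 2 (Cycle n □ Cycle n □ Cycle (6 * k))
  sixfold n 14≤n n≤19 =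
    subst (λ n → HasQuasiPerfectCode 2 (Cycle n □ Cycle n □ Cycle (6 * k))) (m+[n∸m]≡n 14≤n)
          (sixfoldCodes k 1≤k (n ∸ 14) (∸-monoˡ-≤ 14 n≤19))
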